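{- If a bipartite graph $G$ with parts $A$ and $B$ contains no induced matching $nK_2$, then there is a set $S\subseteq A$ with $|S|\le n-1$ such that $N(S)=N(A)$.
   Context: For a vertex set $S$, $N(S)=\bigcup_{v\in S}N(v)$. -}

module Defs where

open import Data.Nat using (ℕ)
open import Data.Bool using (Bool; true)
open import Data.Fin using (Fin)
open import Data.Fin.Subset using (Subset; _∈_; ⊤)
open import Data.Product using (Σ; _×_; ∃)
open import Relation.Binary.PropositionalEquality using (_≡_)
open import Relation.Nullary using (¬_)
open import Function.Definitions using (Injective)

-- A finite bipartite graph with parts A = Fin a and B = Fin b.
-- All edges go between A and B; adjacency is given (decidably) by a Bool matrix.
record BipartiteGraph (a b : ℕ) : Set where
  field
    adj : Fin a → Fin b → Bool

open BipartiteGraph public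

Adj : ∀ {a b} → BipartiteGraph a b → Fin a → Fin b → Set
Adj G x y = adj G x y ≡ true

N : ∀ {a b} → BipartiteGraph a b → Subset a → Fin b → Set
N G S y = ∃ λ x → x ∈ S × Adj G x y

-- G contains an induced matching nK₂: n edges x i — y i (x i ∈ A, y i ∈ B),
-- with all 2n endpoints distinct, and x i adjacent to y j iff i ≡ j
-- (in a bipartite graph these are the only possible edges among these vertices).
record InducedMatching {a b} (G : BipartiteGraph a b) (n : ℕ) : Set where
  field
    left    : Fin n → Fin a
    right   : Fin n → Fin b
    left-inj  : Injective _≡_ _≡_ left
    right-inj : Injective _≡_ _≡_ right
    edge    : ∀ i → Adj G (left i) (right i)
    nonedge : ∀ i j → ¬ (i ≡ j) → ¬ Adj G (left i) (right j)

module Submission where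

-- Call S ⊆ A a cover if N(S) = N(A), and a cover S irredundant if no
-- S - x (x ∈ S) is still a cover.  Removing elements one at a time from the
-- cover A (well-founded recursion on strict inclusion) yields an irredundant
-- cover S.  In an irredundant cover every x ∈ S has a private neighbour: a
-- vertex of B adjacent to x and to no other vertex of S.  Choosing n distinct
-- vertices of S together with their private neighbours gives an induced
-- matching nK₂; hence |S| < n, i.e. |S| ≤ n - 1.

open import Defs
open import Data.Nat using (ℕ; _≤_; _∸_; _<_)
open import Data.Nat.Properties using (_≤?_; ≰⇒>; suc[m]≤n⇒m≤pred[n]; pred[m∸n]≡m∸[1+n])
open import Data.Fin using (Fin; zero; suc; _≟_; inject≤)
open import Data.Fin.Properties using (any?; all?; ¬∀⟶∃¬; suc-injective; inject≤-injective)
open import Data.Fin.Subset using (Subset; ∣_∣; ⊤; _∈_; _⊂_; _-_; inside; outside)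
open import Data.Fin.Subset.Properties using (_∈?_; ∈⊤; x∈p∧x≢y⇒x∈p-y; x∈p⇒p-x⊂p)
open import Data.Fin.Subset.Induction using (Acc; acc; ⊂-wellFounded)
open import Data.Vec using (_∷_; here; there)
open import Data.Bool using (true)
open import Data.Bool.Properties using () renaming (_≟_ to _≟ᵇ_)
open import Data.Product using (Σ; _×_; _,_; proj₁; proj₂; ∃)
open import Function.Bundles using (_⇔_; mk⇔)
open import Function.Definitions using (Injective)
open import Relation.Nullary using (¬_; Dec; yes; no; contradiction)
open import Relation.Nullary.Decidable using (_×-dec_; _→-dec_)
open import Relation.Binary.PropositionalEquality using (_≡_; refl; cong; subst; sym)

enum : ∀ {a} (S : Subset a) → Fin ∣ S ∣ → Fin a
enum (inside  ∷ S) zero    = zero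
enum (inside  ∷ S) (suc i) = suc (enum S i)
enum (outside ∷ S) i       = suc (enum S i)

enum-∈ : ∀ {a} (S : Subset a) (i : Fin ∣ S ∣) → enum S i ∈ S
enum-∈ (inside  ∷ S) zero    = here
enum-∈ (inside  ∷ S) (suc i) = there (enum-∈ S i)
enum-∈ (outside ∷ S) i       = there (enum-∈ S i)

enum-injective : ∀ {a} (S : Subset a) → Injective _≡_ _≡_ (enum S)
enum-injective (inside  ∷ S) {zero}  {zero}  _ = refl
enum-injective (inside  ∷ S) {suc i} {suc j} e =
  cong suc (enum-injective S (suc-injective e))
enum-injective (outside ∷ S) e = enum-injective S (suc-injective e)

<⇒≤∸1 : ∀ {m n} → m < n → m ≤ n ∸ 1
<⇒≤∸1 {m} {n} m<n = subst (m ≤_) (pred[m∸n]≡m∸[1+n] n 0) (suc[m]≤n⇒m≤pred[n] m<n)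

module _ {a b : ℕ} (G : BipartiteGraph a b) where

  -- Adjacency, neighbourhoods and the cover property are decidable, which
  -- lets the recursion below test for a redundant vertex.
  Adj? : ∀ x y → Dec (Adj G x y)
  Adj? x y = adj G x y ≟ᵇ true

  N? : ∀ S y → Dec (N G S y)
  N? S y = any? (λ x → (x ∈? S) ×-dec Adj? x y)

  -- S ⊆ A is a cover if N(A) ⊆ N(S); the converse inclusion always holds,
  -- so covers are exactly the sets with N(S) = N(A).
  Covers : Subset a → Set
  Covers S = ∀ y → N G ⊤ y → N G S y

  Covers? : ∀ S → Dec (Covers S)
  Covers? S = all? (λ y → N? ⊤ y →-dec N? S y)

  Irredundant : Subset a → Set
  Irredundant S = ∀ x → x ∈ S → ¬ Covers (S - x)

  PrivateNeighbour : Subset a → Fin a → Fin b → Set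
  PrivateNeighbour S x y = Adj G x y × (∀ x′ → x′ ∈ S → Adj G x′ y → x′ ≡ x)

  irredundantCover : ∀ S → Acc _⊂_ S → Covers S → Σ (Subset a) λ S′ → Covers S′ × Irredundant S′
  irredundantCover S (acc smaller) cov with any? (λ x → (x ∈? S) ×-dec Covers? (S - x))
  ... | yes (x , x∈S , cov′) = irredundantCover (S - x) (smaller (x∈p⇒p-x⊂p x∈S)) cov′
  ... | no  noneRedundant    = S , cov , λ x x∈S cov′ → noneRedundant (x , x∈S , cov′)

  uncoveredVertex : ∀ S → ¬ Covers S → ∃ λ y → N G ⊤ y × ¬ N G S y
  uncoveredVertex S ¬cov with ¬∀⟶∃¬ b _ (λ y → N? ⊤ y →-dec N? S y) ¬cov
  ... | y , ¬implication with N? ⊤ y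
  ...   | yes y∈NA = y , y∈NA , λ y∈NS → ¬implication (λ _ → y∈NS)
  ...   | no  y∉NA = contradiction (λ y∈NA → contradiction y∈NA y∉NA) ¬implication

  -- In an irredundant cover, a vertex y ∈ N(A) \ N(S - x) witnessing that x is
  -- needed is a private neighbour of x.
  privateNeighbour : ∀ S → Covers S → Irredundant S → ∀ x → x ∈ S → ∃ (PrivateNeighbour S x)
  privateNeighbour S cov irr x x∈S with uncoveredVertex (S - x) (irr x x∈S)
  ... | y , y∈NA , y∉NS-x = y , adjxy , unique
    where
    unique : ∀ x′ → x′ ∈ S → Adj G x′ y → x′ ≡ x
    unique x′ x′∈S adj′ with x′ ≟ x
    ... | yes x′≡x = x′≡x
    ... | no  x′≢x = contradiction (x′ , x∈p∧x≢y⇒x∈p-y x′∈S x′≢x , adj′) y∉NS-x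

    adjxy : Adj G x y
    adjxy with cov y y∈NA
    ... | x′ , x′∈S , adj′ = subst (λ z → Adj G z y) (unique x′ x′∈S adj′) adj′

  inducedMatching : ∀ n S → (∀ x → x ∈ S → ∃ (PrivateNeighbour S x)) → n ≤ ∣ S ∣ →
    InducedMatching G n
  inducedMatching n S hasPrivate n≤∣S∣ = record
    { left      = left
    ; right     = right
    ; left-inj  = left-inj
    ; right-inj = λ {i} {j} e → sym (onlyNeighbour j i (subst (Adj G (left i)) e (edge i)))
    ; edge      = edge
    ; nonedge   = λ i j i≢j adjij → i≢j (sym (onlyNeighbour j i adjij))
    }
    where
    left : Fin n → Fin a
    left i = enum S (inject≤ i n≤∣S∣)

    left-inj : Injective _≡_ _≡_ left
    left-inj {i} {j} e = inject≤-injective n≤∣S∣ n≤∣S∣ i j (enum-injective S e)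

    left-∈ : ∀ i → left i ∈ S
    left-∈ i = enum-∈ S (inject≤ i n≤∣S∣)

    right : Fin n → Fin b
    right i = proj₁ (hasPrivate (left i) (left-∈ i))

    edge : ∀ i → Adj G (left i) (right i)
    edge i = proj₁ (proj₂ (hasPrivate (left i) (left-∈ i)))

    onlyNeighbour : ∀ j i → Adj G (left i) (right j) → j ≡ i
    onlyNeighbour j i adjij =
      left-inj (sym (proj₂ (proj₂ (hasPrivate (left j) (left-∈ j))) (left i) (left-∈ i) adjij))

mainTheorem6 : ∀ {a b : ℕ} (G : BipartiteGraph a b) (n : ℕ) →
    ¬ InducedMatching G n →
    Σ (Subset a) λ S → (∣ S ∣ ≤ n ∸ 1) × (∀ (y : Fin b) → N G S y ⇔ N G ⊤ y)
mainTheorem6 G n noMatching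
  with irredundantCover G ⊤ (⊂-wellFounded ⊤) (λ y y∈NA → y∈NA)
... | S , cov , irr = S , size , λ y → mk⇔ (λ { (x , _ , adjxy) → x , ∈⊤ , adjxy }) (cov y)
  where
  size : ∣ S ∣ ≤ n ∸ 1
  size with n ≤? ∣ S ∣
  ... | yes n≤∣S∣ = contradiction (inducedMatching G n S (privateNeighbour G S cov irr) n≤∣S∣) noMatching
  ... | no  n≰∣S∣ = <⇒≤∸1 (≰⇒> n≰∣S∣)
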